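{- Let $a$ and $b$ be positive, relatively prime integers, $S=\{a,b\}$, and let $c$ be any integer. The following are equivalent: (i) $c$ is a Frobenius value with respect to $S$; (ii) the $a$-normal form $c=\alpha a+\beta b$ of $c$ satisfies $-a<\beta<0<\alpha<b$; (iii) the $b$-normal form $c=\alpha a+\beta b$ of $c$ satisfies $-b<\alpha<0<\beta<a$.
   Context: An integer $c$ is a Frobenius value with respect to $S=\{a,b\}$ if it cannot be written as $xa+yb$ with integers $x,y\ge 0$, nor as $xa+yb$ with integers $x,y\le 0$. Every integer $c$ has a unique representation $c=\alpha a+\beta b$ with integers $\alpha,\beta$ and $0\le\alpha<b$, called its $a$-normal form, and a unique representation $c=\alpha a+\beta b$ with integers $\alpha,\beta$ and $0\le\beta<a$, called its $b$-normal form. -}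

module Defs where

open import Data.Nat using (ℕ)
open import Data.Integer using (ℤ; +_; _+_; _*_; _≤_; _<_; -_; 0ℤ)
open import Data.Product using (Σ; _×_)
open import Data.Sum using (_⊎_)
open import Relation.Nullary using (¬_)
open import Relation.Binary.PropositionalEquality using (_≡_)

NonnegComb : ℤ → ℤ → ℤ → Set
NonnegComb a b c = Σ ℤ λ x → Σ ℤ λ y → (0ℤ ≤ x) × (0ℤ ≤ y) × (c ≡ x * a + y * b)

NonposComb : ℤ → ℤ → ℤ → Set
NonposComb a b c = Σ ℤ λ x → Σ ℤ λ y → (x ≤ 0ℤ) × (y ≤ 0ℤ) × (c ≡ x * a + y * b)

IsFrobeniusValue : ℤ → ℤ → ℤ → Set
IsFrobeniusValue a b c = ¬ NonnegComb a b c × ¬ NonposComb a b c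

IsANormalForm : ℤ → ℤ → ℤ → ℤ → ℤ → Set
IsANormalForm a b c α β = (c ≡ α * a + β * b) × (0ℤ ≤ α) × (α < b)

IsBNormalForm : ℤ → ℤ → ℤ → ℤ → ℤ → Set
IsBNormalForm a b c α β = (c ≡ α * a + β * b) × (0ℤ ≤ β) × (β < a)

module Submission where

-- A representation x a + y b of c can be moved by multiples of (b, -a); the a-normal form
-- is the one with 0 ≤ α < b.  If c is a Frobenius value, β ≥ 0 would make the normal form
-- nonnegative, α = 0 would make it nonpositive, and β ≤ -a would make its shift
-- (α - b, β + a) nonpositive.
-- Conversely a nonnegative representation reduces to a normal form with β ≥ 0, and a
-- nonpositive one (x ≤ 0 with x mod b > 0) to one with β ≤ -a.  The b-normal form is the
-- a-normal form with the roles of a and b exchanged.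

open import Defs
open import Data.Nat using (ℕ; NonZero)
open import Data.Nat.Coprimality using (Coprime)
open import Data.Integer using (ℤ; +_; _<_; -_; 0ℤ)
open import Data.Product using (_×_)
open import Function.Bundles using (_⇔_)

open import Data.Nat as ℕ using (z≤n)
open import Data.Integer using (-[1+_]; _+_; _*_; _-_; _≤_; -≤-; +≤+; +<+; _≤?_; -1ℤ)
open import Data.Integer.Properties
open import Data.Integer.DivMod using (_/ℕ_; _%ℕ_; a≡a%ℕn+[a/ℕn]*n; n%ℕd<d; 0≤n⇒0≤n/ℕd)
open import Data.Integer.Tactic.RingSolver using (solve-∀)
open import Data.Product using (_,_)
open import Data.Empty using (⊥-elim)
open import Function.Bundles using (mk⇔)
open import Relation.Nullary using (¬_; yes; no)
open import Relation.Binary.PropositionalEquality using (_≡_; trans; cong; subst)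

NormalBounds : ℤ → ℤ → ℤ → ℤ → Set
NormalBounds a b α β = (- a < β) × (β < 0ℤ) × (0ℤ < α) × (α < b)

<0⇒≤-1 : ∀ {i} → i < 0ℤ → i ≤ -1ℤ
<0⇒≤-1 { -[1+ _ ]} _ = -≤- z≤n
<0⇒≤-1 {+ _} (+<+ ())

combination-shift : ∀ α β a b → α * a + β * b ≡ (α - b) * a + (β + a) * b
combination-shift = solve-∀

combination-reduce : ∀ r q y a b → (r + q * b) * a + y * b ≡ r * a + (y + q * a) * b
combination-reduce = solve-∀

[i+j]-i≡j : ∀ i j → i + j - i ≡ j
[i+j]-i≡j = solve-∀

combination-comm : ∀ {c} x a y b → c ≡ x * a + y * b → c ≡ y * b + x * a
combination-comm x a y b eq = trans eq (+-comm (x * a) (y * b))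

NonnegComb-swap : ∀ {a b c} → NonnegComb a b c → NonnegComb b a c
NonnegComb-swap {a} {b} (x , y , 0≤x , 0≤y , eq) = y , x , 0≤y , 0≤x , combination-comm x a y b eq

NonposComb-swap : ∀ {a b c} → NonposComb a b c → NonposComb b a c
NonposComb-swap {a} {b} (x , y , x≤0 , y≤0 , eq) = y , x , y≤0 , x≤0 , combination-comm x a y b eq

IsFrobeniusValue-swap : ∀ {a b c} → IsFrobeniusValue a b c → IsFrobeniusValue b a c
IsFrobeniusValue-swap (¬nonneg , ¬nonpos) =
  (λ n → ¬nonneg (NonnegComb-swap n)) , (λ n → ¬nonpos (NonposComb-swap n))

IsBNormalForm⇒IsANormalForm-swap : ∀ {a b c α β} →
  IsBNormalForm a b c α β → IsANormalForm b a c β α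
IsBNormalForm⇒IsANormalForm-swap {a} {b} {α = α} {β} (eq , 0≤β , β<a) =
  combination-comm α a β b eq , 0≤β , β<a

IsANormalForm-swap⇒IsBNormalForm : ∀ {a b c α β} →
  IsANormalForm b a c β α → IsBNormalForm a b c α β
IsANormalForm-swap⇒IsBNormalForm {a} {b} {α = α} {β} (eq , 0≤β , β<a) =
  combination-comm β b α a eq , 0≤β , β<a

IsFrobeniusValue⇒normalBounds : ∀ {a b c α β} → IsFrobeniusValue a b c →
  IsANormalForm a b c α β → NormalBounds a b α β
IsFrobeniusValue⇒normalBounds {a} {b} {c} {α} {β} (¬nonneg , ¬nonpos) (eq , 0≤α , α<b) =
  -a<β , β<0 , 0<α , α<b
  where
  β<0 : β < 0ℤ
  β<0 with 0ℤ ≤? β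
  ... | yes 0≤β = ⊥-elim (¬nonneg (α , β , 0≤α , 0≤β , eq))
  ... | no  β≱0 = ≰⇒> β≱0
  0<α : 0ℤ < α
  0<α with α ≤? 0ℤ
  ... | yes α≤0 = ⊥-elim (¬nonpos (α , β , α≤0 , <⇒≤ β<0 , eq))
  ... | no  α≰0 = ≰⇒> α≰0
  -a<β : - a < β
  -a<β with β ≤? - a
  ... | no  β≰-a = ≰⇒> β≰-a
  ... | yes β≤-a = ⊥-elim (¬nonpos (α - b , β + a , i≤j⇒i-j≤0 (<⇒≤ α<b) ,
          subst (β + a ≤_) (+-inverseˡ a) (+-monoˡ-≤ a β≤-a) ,
          trans eq (combination-shift α β a b)))

module _ (b : ℕ) .{{_ : NonZero b}} where

  n≤0∧0<n%ℕd⇒n/ℕd<0 : ∀ x → x ≤ 0ℤ → 0ℤ < + (x %ℕ b) → x /ℕ b < 0ℤ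
  n≤0∧0<n%ℕd⇒n/ℕd<0 x x≤0 0<r = *-cancelʳ-<-nonNeg (+ b) (begin-strict
    x /ℕ b * + b         ≡⟨ [i+j]-i≡j r (x /ℕ b * + b) ⟨
    r + x /ℕ b * + b - r ≡⟨ cong (_- r) (a≡a%ℕn+[a/ℕn]*n x b) ⟨
    x - r                <⟨ +-mono-≤-< x≤0 (neg-mono-< 0<r) ⟩
    0ℤ                   ≡⟨ *-zeroˡ (+ b) ⟨
    0ℤ * + b             ∎)
    where
    open ≤-Reasoning
    r = + (x %ℕ b)

  module _ (a : ℕ) where

    toANormalForm : ∀ {c} x y → c ≡ x * + a + y * + b →
      IsANormalForm (+ a) (+ b) c (+ (x %ℕ b)) (y + (x /ℕ b) * + a)
    toANormalForm x y eq =
      trans eq (trans (cong (λ t → t * + a + y * + b) (a≡a%ℕn+[a/ℕn]*n x b))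
                      (combination-reduce (+ (x %ℕ b)) (x /ℕ b) y (+ a) (+ b))) ,
      +≤+ z≤n , +<+ (n%ℕd<d x b)

    normalBounds⇒IsFrobeniusValue : ∀ {c} →
      (∀ α β → IsANormalForm (+ a) (+ b) c α β → NormalBounds (+ a) (+ b) α β) →
      IsFrobeniusValue (+ a) (+ b) c
    normalBounds⇒IsFrobeniusValue {c} bounds = ¬nonneg , ¬nonpos
      where
      ¬nonneg : ¬ NonnegComb (+ a) (+ b) c
      ¬nonneg (x , y , 0≤x , 0≤y , eq) with bounds _ _ (toANormalForm x y eq)
      ... | _ , β<0 , _ = <⇒≱ β<0
        (+-mono-≤ 0≤y (*-monoʳ-≤-nonNeg (+ a) (0≤n⇒0≤n/ℕd x b 0≤x)))
      ¬nonpos : ¬ NonposComb (+ a) (+ b) c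
      ¬nonpos (x , y , x≤0 , y≤0 , eq) with bounds _ _ (toANormalForm x y eq)
      ... | -a<β , _ , 0<α , _ = <⇒≱ -a<β (begin
        y + x /ℕ b * + a ≤⟨ +-mono-≤ y≤0 (*-monoʳ-≤-nonNeg (+ a) (<0⇒≤-1 (n≤0∧0<n%ℕd⇒n/ℕd<0 x x≤0 0<α))) ⟩
        0ℤ + -1ℤ * + a   ≡⟨ +-identityˡ (-1ℤ * + a) ⟩
        -1ℤ * + a        ≡⟨ -1*i≡-i (+ a) ⟩
        - + a            ∎)
        where open ≤-Reasoning

lemma2 : (a b : ℕ) → NonZero a → NonZero b → Coprime a b → (c : ℤ) →
    (IsFrobeniusValue (+ a) (+ b) c ⇔
      ((α β : ℤ) → IsANormalForm (+ a) (+ b) c α β →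
        (- (+ a) < β) × (β < 0ℤ) × (0ℤ < α) × (α < + b)))
    × (IsFrobeniusValue (+ a) (+ b) c ⇔
      ((α β : ℤ) → IsBNormalForm (+ a) (+ b) c α β →
        (- (+ b) < α) × (α < 0ℤ) × (0ℤ < β) × (β < + a)))
lemma2 a b nonZero-a nonZero-b _ c =
  mk⇔ (λ frob _ _ → IsFrobeniusValue⇒normalBounds frob)
      (normalBounds⇒IsFrobeniusValue b {{nonZero-b}} a) ,
  mk⇔ (λ frob α β nf → IsFrobeniusValue⇒normalBounds (IsFrobeniusValue-swap frob)
                          (IsBNormalForm⇒IsANormalForm-swap {α = α} {β} nf))
      (λ bounds → IsFrobeniusValue-swap (normalBounds⇒IsFrobeniusValue a {{nonZero-a}} b
                    (λ β α nf → bounds α β (IsANormalForm-swap⇒IsBNormalForm {α = α} {β} nf))))
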